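{- For every positive integer $k$, $S(k+3)\ge 33\,S(k)+6$.
   Context: A set of integers is sum-free if it contains no integers $a,b,c$ (not necessarily distinct) with $a+b=c$. For a positive integer $k$, the Schur number $S(k)$ is the largest $n$ such that the interval $[1,n]=\{1,\dots,n\}$ can be partitioned into $k$ sum-free subsets. -}

module Defs where

open import Data.Nat using (ℕ; _+_; _*_; _≤_)
open import Data.Fin using (Fin)
open import Data.Product using (Σ; _×_)
open import Relation.Binary.PropositionalEquality using (_≡_)
open import Relation.Nullary using (¬_)

-- A partition of [1,n] = {1,…,n} into k subsets is given by an assignment
-- c : ℕ → Fin k (only its values on [1,n] matter); part i is {x ∈ [1,n] | c x ≡ i}.
SumFreeColouring : (k n : ℕ) → (ℕ → Fin k) → Set
SumFreeColouring k n c =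
  ∀ a b → 1 ≤ a → 1 ≤ b → a + b ≤ n →
    ¬ (c a ≡ c b × c b ≡ c (a + b))

Partitionable : ℕ → ℕ → Set
Partitionable k n = Σ (ℕ → Fin k) (SumFreeColouring k n)

IsSchurNumber : ℕ → ℕ → Set
IsSchurNumber k s = Partitionable k s × (∀ m → Partitionable k m → m ≤ s)

{-# OPTIONS --safe #-}
-- Write x + 26 = 33 q + e with 0 ≤ e < 33.  Eleven of the 33 offsets e are "old": x then
-- takes the colour of q under a sum-free k-colouring of [1, s]; the other 22 offsets are
-- split into three classes, each sum-free modulo 33.  Old offsets add without wrap-around
-- (e₁ + e₂ ≡ e₃ + 26 mod 33 forces e₁ + e₂ = e₃ + 26), so on old-coloured numbers q is
-- additive and a monochromatic a + b = c would give one for the q's.  For x ∈ [1, 33 s + 6]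
-- with old offset, q lies in [1, s].
module Submission where

open import Defs
open import Data.Nat using (ℕ; suc; NonZero; _+_; _*_; _≤_; _≟_; _≤?_; s≤s)
open import Data.Nat.Properties
  using ( +-cancelˡ-≡; *-cancelʳ-≡; +-monoˡ-≤; +-identityʳ; n≢0⇒n>0; <-irrefl
        ; ≤-pred; ≤-trans; ≤-reflexive; module ≤-Reasoning)
open import Data.Nat.DivMod
  using (_/_; _%_; _mod_; m≡m%n+[m/n]*n; [m+n]%n≡m%n; %-distribˡ-+; m%n<n; m<n*o⇒m/o<n)
open import Data.Nat.Tactic.RingSolver using (solve-∀)
open import Data.Fin using (Fin; toℕ; join; splitAt) renaming (_≟_ to _≟ᶠ_)
open import Data.Fin.Patterns using (0F; 1F; 2F)
open import Data.Fin.Properties using (all?; toℕ-fromℕ<; toℕ-injective; splitAt-join)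
open import Data.Maybe using (Maybe; just; nothing; maybe′)
open import Data.Maybe.Properties using (≡-dec)
open import Data.Vec using (_∷_; []; lookup)
open import Data.Sum using (_⊎_; inj₁; inj₂)
open import Data.Sum.Properties using (inj₁-injective)
open import Data.Product using (_,_)
open import Data.Empty using (⊥)
open import Function using (_∘_)
open import Relation.Binary.PropositionalEquality
  using (_≡_; _≢_; refl; sym; trans; cong; cong₂; subst; module ≡-Reasoning)
open import Relation.Nullary using (Dec; ¬?)
open import Relation.Nullary.Decidable using (toWitness; _→-dec_)

toℕ-mod : ∀ m n .{{_ : NonZero n}} → toℕ (m mod n) ≡ m % n
toℕ-mod m n = toℕ-fromℕ< (m%n<n m n)

quotient-+ : ∀ m .{{_ : NonZero m}} {x y r₁ r₂ q₁ q₂ q₃} →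
  x ≡ r₁ + q₁ * m → y ≡ r₂ + q₂ * m → x + y ≡ (r₁ + r₂) + q₃ * m → q₃ ≡ q₁ + q₂
quotient-+ m {x} {y} {r₁} {r₂} {q₁} {q₂} {q₃} x≡ y≡ x+y≡ =
  *-cancelʳ-≡ q₃ (q₁ + q₂) m (+-cancelˡ-≡ (r₁ + r₂) _ _ (begin
    (r₁ + r₂) + q₃ * m          ≡⟨ sym x+y≡ ⟩
    x + y                        ≡⟨ cong₂ _+_ x≡ y≡ ⟩
    (r₁ + q₁ * m) + (r₂ + q₂ * m) ≡⟨ regroup r₁ r₂ q₁ q₂ m ⟩
    (r₁ + r₂) + (q₁ + q₂) * m   ∎))
  where
  open ≡-Reasoning
  regroup : ∀ r₁ r₂ q₁ q₂ m → (r₁ + q₁ * m) + (r₂ + q₂ * m) ≡ (r₁ + r₂) + (q₁ + q₂) * m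
  regroup = solve-∀

join-injective : ∀ m n {u v : Fin m ⊎ Fin n} → join m n u ≡ join m n v → u ≡ v
join-injective m n {u} {v} eq =
  trans (sym (splitAt-join m n u)) (trans (cong (splitAt m) eq) (splitAt-join m n v))

-- nothing: the offset is old; just c: new colour c.
template : Fin 33 → Maybe (Fin 3)
template = lookup
  (o ∷ o ∷ A ∷ C ∷ C ∷ C ∷ A ∷ B ∷ B ∷ A ∷ o ∷ o ∷ o ∷ o ∷ o ∷ o ∷ o ∷
   A ∷ B ∷ B ∷ A ∷ C ∷ C ∷ C ∷ A ∷ o ∷ o ∷ A ∷ B ∷ C ∷ C ∷ B ∷ A ∷ [])
  where
  o = nothing
  A = just 0F
  B = just 1F
  C = just 2F

offset : ℕ → Fin 33
offset x = (x + 26) mod 33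

block : ℕ → ℕ
block x = (x + 26) / 33

_⊕_ : Fin 33 → Fin 33 → Fin 33
e₁ ⊕ e₂ = (toℕ e₁ + toℕ e₂ + 7) mod 33

_≟ₘ_ : (u v : Maybe (Fin 3)) → Dec (u ≡ v)
_≟ₘ_ = ≡-dec _≟ᶠ_

old-offsets-add-exactly : ∀ e₁ e₂ → template e₁ ≡ nothing → template e₂ ≡ nothing →
  template (e₁ ⊕ e₂) ≡ nothing → toℕ e₁ + toℕ e₂ ≡ toℕ (e₁ ⊕ e₂) + 26
old-offsets-add-exactly = toWitness {a? = all? λ e₁ → all? λ e₂ →
  (template e₁ ≟ₘ nothing) →-dec (template e₂ ≟ₘ nothing) →-dec
  (template (e₁ ⊕ e₂) ≟ₘ nothing) →-dec (toℕ e₁ + toℕ e₂ ≟ toℕ (e₁ ⊕ e₂) + 26)} _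

new-classes-sum-free : ∀ e₁ e₂ c → template e₁ ≡ just c → template e₂ ≡ just c →
  template (e₁ ⊕ e₂) ≢ just c
new-classes-sum-free = toWitness {a? = all? λ e₁ → all? λ e₂ → all? λ c →
  (template e₁ ≟ₘ just c) →-dec (template e₂ ≟ₘ just c) →-dec
  ¬? (template (e₁ ⊕ e₂) ≟ₘ just c)} _

old-offset-≤ : ∀ e → template e ≡ nothing → toℕ e ≤ 26
old-offset-≤ = toWitness {a? = all? λ e → (template e ≟ₘ nothing) →-dec (toℕ e ≤? 26)} _

offset+block : ∀ x → x + 26 ≡ toℕ (offset x) + block x * 33
offset+block x =
  trans (m≡m%n+[m/n]*n (x + 26) 33) (cong (_+ block x * 33) (sym (toℕ-mod (x + 26) 33)))

offset-+ : ∀ a b → offset (a + b) ≡ offset a ⊕ offset b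
offset-+ a b = toℕ-injective (begin
  toℕ (offset (a + b))                  ≡⟨ toℕ-mod (a + b + 26) 33 ⟩
  (a + b + 26) % 33                      ≡⟨ sym ([m+n]%n≡m%n (a + b + 26) 33) ⟩
  (a + b + 26 + 33) % 33                 ≡⟨ cong (_% 33) (shift a b) ⟩
  ((a + 26) + (b + 26) + 7) % 33         ≡⟨ %-distribˡ-+ ((a + 26) + (b + 26)) 7 33 ⟩
  (((a + 26) + (b + 26)) % 33 + 7) % 33  ≡⟨ cong (λ n → (n + 7) % 33) (%-distribˡ-+ (a + 26) (b + 26) 33) ⟩
  ((ra + rb) % 33 + 7) % 33              ≡⟨ sym (%-distribˡ-+ (ra + rb) 7 33) ⟩
  (ra + rb + 7) % 33                     ≡⟨ cong₂ (λ m n → (m + n + 7) % 33) (sym (toℕ-mod (a + 26) 33))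
                                                                               (sym (toℕ-mod (b + 26) 33)) ⟩
  (ea + eb + 7) % 33                     ≡⟨ sym (toℕ-mod (ea + eb + 7) 33) ⟩
  toℕ (offset a ⊕ offset b)             ∎)
  where
  open ≡-Reasoning
  ra = (a + 26) % 33
  rb = (b + 26) % 33
  ea = toℕ (offset a)
  eb = toℕ (offset b)
  shift : ∀ a b → a + b + 26 + 33 ≡ (a + 26) + (b + 26) + 7
  shift = solve-∀

block-+ : ∀ a b → template (offset a) ≡ nothing → template (offset b) ≡ nothing →
  template (offset (a + b)) ≡ nothing → block (a + b) ≡ block a + block b
block-+ a b old-a old-b old-a+b =
  quotient-+ 33 {r₁ = e₁} {r₂ = e₂} {q₁ = block a} {q₂ = block b}
    (offset+block a) (offset+block b) (begin
  (a + 26) + (b + 26)                      ≡⟨ regroup a b ⟩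
  (a + b + 26) + 26                        ≡⟨ cong (_+ 26) (offset+block (a + b)) ⟩
  (e₃ + block (a + b) * 33) + 26           ≡⟨ swap e₃ (block (a + b)) ⟩
  (e₃ + 26) + block (a + b) * 33           ≡⟨ cong (_+ block (a + b) * 33) (sym exact) ⟩
  (e₁ + e₂) + block (a + b) * 33           ∎)
  where
  open ≡-Reasoning
  e₁ = toℕ (offset a)
  e₂ = toℕ (offset b)
  e₃ = toℕ (offset (a + b))
  exact : e₁ + e₂ ≡ e₃ + 26
  exact = subst (λ e → e₁ + e₂ ≡ toℕ e + 26) (sym (offset-+ a b))
    (old-offsets-add-exactly (offset a) (offset b) old-a old-b
      (subst (λ e → template e ≡ nothing) (offset-+ a b) old-a+b))
  regroup : ∀ a b → (a + 26) + (b + 26) ≡ (a + b + 26) + 26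
  regroup = solve-∀
  swap : ∀ e q → (e + q * 33) + 26 ≡ (e + 26) + q * 33
  swap = solve-∀

block-≥1 : ∀ {x} → 1 ≤ x → template (offset x) ≡ nothing → 1 ≤ block x
block-≥1 {x} 1≤x old = n≢0⇒n>0 λ block≡0 → <-irrefl refl (begin
  27                                ≤⟨ +-monoˡ-≤ 26 1≤x ⟩
  x + 26                            ≡⟨ offset+block x ⟩
  toℕ (offset x) + block x * 33     ≡⟨ cong (λ q → toℕ (offset x) + q * 33) block≡0 ⟩
  toℕ (offset x) + 0                ≡⟨ +-identityʳ _ ⟩
  toℕ (offset x)                    ≤⟨ old-offset-≤ (offset x) old ⟩
  26                                ∎)
  where open ≤-Reasoning

block-≤ : ∀ {x} s → x ≤ 33 * s + 6 → block x ≤ s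
block-≤ {x} s x≤ = ≤-pred (m<n*o⇒m/o<n (≤-trans (s≤s (+-monoˡ-≤ 26 x≤)) (≤-reflexive (top s))))
  where
  top : ∀ s → suc (33 * s + 6 + 26) ≡ suc s * 33
  top = solve-∀

extend : ∀ {k} → (ℕ → Fin k) → ℕ → Fin k ⊎ Fin 3
extend f x = maybe′ inj₂ (inj₁ (f (block x))) (template (offset x))

extend-sumFree : ∀ {k s} (f : ℕ → Fin k) → SumFreeColouring k s f →
  SumFreeColouring (k + 3) (33 * s + 6) (join k 3 ∘ extend f)
extend-sumFree {k} {s} f f-sumFree a b 1≤a 1≤b a+b≤ (c₁≡c₂ , c₂≡c₃) =
  not-monochromatic (join-injective k 3 c₁≡c₂) (join-injective k 3 c₂≡c₃)
  where
  not-monochromatic : extend f a ≡ extend f b → extend f b ≡ extend f (a + b) → ⊥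
  not-monochromatic p q
    with template (offset a) in old-a | template (offset b) in old-b
       | template (offset (a + b)) in old-a+b
  ... | nothing | nothing | nothing =
    f-sumFree (block a) (block b) (block-≥1 1≤a old-a) (block-≥1 1≤b old-b)
      (subst (_≤ s) additive (block-≤ s a+b≤))
      (inj₁-injective p , trans (inj₁-injective q) (cong f additive))
    where
    additive : block (a + b) ≡ block a + block b
    additive = block-+ a b old-a old-b old-a+b
  not-monochromatic refl refl | just c | just .c | just .c =
    new-classes-sum-free (offset a) (offset b) c old-a old-b
      (trans (cong template (sym (offset-+ a b))) old-a+b)
  not-monochromatic () q | nothing | just _ | _
  not-monochromatic () q | just _ | nothing | _
  not-monochromatic p () | nothing | nothing | just _
  not-monochromatic p () | just _ | just _ | nothing

-- The construction works for every k.
mainTheorem5 : (k s t : ℕ) → 1 ≤ k → IsSchurNumber k s → IsSchurNumber (k + 3) t →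
    33 * s + 6 ≤ t
mainTheorem5 k s t _ ((f , f-sumFree) , _) (_ , t-maximal) =
  t-maximal (33 * s + 6) (join k 3 ∘ extend f , extend-sumFree f f-sumFree)
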